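{- Let $0\le k\le n$. Identify $P_{k,n-k}=J([k]\times[n-k])$ with the set of lattice paths from $(0,0)$ to $(n,2k-n)$ with steps $U=(1,1)$, $D=(1,-1)$, so that for paths $p,q$ with heights $p_i,q_i$ after $i$ steps, $p\le q$ iff $p_i\le q_i$ for all $i$. Define $A(p,q)$, for $(p,q)\in P_{k,n-k}\times P_{k,n-k}$, as the path whose $i$th step is $U$, $D$, $O_1$, $O_2$ according as the pair of $i$th steps of $(p,q)$ is $(D,U)$, $(U,D)$, $(U,U)$, $(D,D)$ respectively. Then $A$ is a bijection from $P_{k,n-k}\times P_{k,n-k}$ to $\mathcal W_{n,k}$ satisfying $d(p,q)=d(A(p,q))$, where on the left $d$ is the distance in the Hasse diagram of $P_{k,n-k}$, and $A$ restricts to a bijection from $\{(p,q): p\le q\}$ onto $\mathcal M_{n,k}$.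
   Context: $J(P)$ is the lattice of order ideals under inclusion; $[k]\times[n-k]$ is a product of chains with componentwise order. Steps: $U=(1,1)$, $D=(1,-1)$, and two distinguishable horizontal steps $O_1=O_2=(1,0)$. A bilateral Motzkin path is a lattice path from $(0,0)$ to $(n,0)$ using steps $U,D,O_1,O_2$; $\mathcal W_{n,k}$ is the set of those ending at $(n,0)$ using exactly $k$ steps of type $U$ or $O_1$. $\mathcal M_{n,k}\subseteq\mathcal W_{n,k}$ consists of those staying weakly above the $x$-axis (bicolored Motzkin paths). For a path $r$ of length $n$ with heights $r_0=0,r_1,\dots,r_n$, $d(r)=|r_0|+|r_1|+\dots+|r_{n-1}|+\tfrac12|r_n|$ (for paths ending on the axis this is $\sum_i |r_i|$). -}

module Defs where

open import Data.Nat as ℕ using (ℕ; zero; suc)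
open import Data.Integer as ℤ using (ℤ; +_; -_; _+_; ∣_∣)
open import Data.Fin using (Fin; fromℕ)
open import Data.Vec using (Vec; []; _∷_; map; lookup)
open import Data.Product using (_×_)
open import Data.Sum using (_⊎_)
open import Relation.Binary.PropositionalEquality using (_≡_; _≢_)

data Step : Set where
  U D : Step

stepVal : Step → ℤ
stepVal U = + 1
stepVal D = - (+ 1)

heights : ∀ {n} → Vec Step n → Vec ℤ (suc n)
heights []      = + 0 ∷ []
heights (s ∷ v) = + 0 ∷ map (λ h → stepVal s + h) (heights v)

InP : (n k : ℕ) → Vec Step n → Set
InP n k p = lookup (heights p) (fromℕ n) ≡ (+ (2 ℕ.* k)) ℤ.- (+ n)

_≼_ : ∀ {n} → Vec Step n → Vec Step n → Set
_≼_ {n} p q = (i : Fin (suc n)) → lookup (heights p) i ℤ.≤ lookup (heights q) i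

Covers : (n k : ℕ) → Vec Step n → Vec Step n → Set
Covers n k p q =
  InP n k p × InP n k q × p ≼ q × p ≢ q ×
  ((r : Vec Step n) → InP n k r → p ≼ r → r ≼ q → r ≡ p ⊎ r ≡ q)

data Walk (n k : ℕ) : Vec Step n → Vec Step n → ℕ → Set where
  here : ∀ {p} → InP n k p → Walk n k p p 0
  step : ∀ {p r q m} → (Covers n k p r ⊎ Covers n k r p) →
         Walk n k r q m → Walk n k p q (suc m)

HasseDist : (n k : ℕ) → Vec Step n → Vec Step n → ℕ → Set
HasseDist n k p q m = Walk n k p q m × ((m' : ℕ) → Walk n k p q m' → m ℕ.≤ m')

data Step4 : Set where
  U′ D′ O₁ O₂ : Step4

step4Val : Step4 → ℤ
step4Val U′ = + 1
step4Val D′ = - (+ 1)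
step4Val O₁ = + 0
step4Val O₂ = + 0

heights4 : ∀ {n} → Vec Step4 n → Vec ℤ (suc n)
heights4 []      = + 0 ∷ []
heights4 (s ∷ v) = + 0 ∷ map (λ h → step4Val s + h) (heights4 v)

countUO₁ : ∀ {n} → Vec Step4 n → ℕ
countUO₁ []        = 0
countUO₁ (U′ ∷ v)  = suc (countUO₁ v)
countUO₁ (O₁ ∷ v)  = suc (countUO₁ v)
countUO₁ (D′ ∷ v)  = countUO₁ v
countUO₁ (O₂ ∷ v)  = countUO₁ v

InW : (n k : ℕ) → Vec Step4 n → Set
InW n k r = lookup (heights4 r) (fromℕ n) ≡ + 0 × countUO₁ r ≡ k

InM : (n k : ℕ) → Vec Step4 n → Set
InM n k r = InW n k r × ((i : Fin (suc n)) → + 0 ℤ.≤ lookup (heights4 r) i)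

-- d(r) = |r_0| + … + |r_{n-1}| + ½|r_n|; for paths ending on the axis
-- (r_n = 0, the only case used) this is the sum of all |r_i|.
sumAbs : ∀ {m} → Vec ℤ m → ℕ
sumAbs []       = 0
sumAbs (x ∷ xs) = ∣ x ∣ ℕ.+ sumAbs xs

dPath : ∀ {n} → Vec Step4 n → ℕ
dPath r = sumAbs (heights4 r)

A-step : Step → Step → Step4
A-step D U = U′
A-step U D = D′
A-step U U = O₁
A-step D D = O₂

A : ∀ {n} → Vec Step n → Vec Step n → Vec Step4 n
A []      []      = []
A (s ∷ p) (t ∷ q) = A-step s t ∷ A p q

-- The i-th height of A(p,q) is half the gap q_i − p_i, so d(A(p,q)) = Σᵢ |q_i − p_i| / 2.
-- This quantity δ is a pseudometric which is additive along chains p ≼ r ≼ q, and it is 1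
-- on each flip DU ↦ UD, hence on each cover, so δ is a lower bound for the Hasse distance.
-- Conversely, if p ≠ q then a flip of p (when A(p,q) first leaves the axis upwards) or of q
-- (when it first leaves downwards) lowers δ by one: this gives a walk of length δ.
module Submission where

open import Defs
open import Data.Nat using (ℕ; _≤_)
open import Data.Vec using (Vec)
open import Data.Product using (_×_; Σ-syntax)
open import Relation.Binary.PropositionalEquality using (_≡_)

open import Data.Nat using (zero; suc; z≤n; s≤s)
import Data.Nat as ℕ
import Data.Nat.Properties as ℕₚ
open import Data.Integer as ℤ using (ℤ; +_; -[1+_]; _+_; -_; _-_; ∣_∣; +≤+)
import Data.Integer.Properties as ℤₚ
open import Data.Integer.Tactic.RingSolver using (solve-∀)
open import Data.Fin using (Fin; fromℕ)
open import Data.Vec using ([]; _∷_; map; zipWith; lookup)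
open import Data.Vec.Properties using (lookup-map; lookup-zipWith; ∷-injectiveʳ)
open import Data.Vec.Relation.Unary.All using (All; []; _∷_)
open import Data.Vec.Relation.Unary.All.Properties using (lookup⁺; lookup⁻)
open import Data.Product using (_,_; proj₁; proj₂)
open import Data.Sum using (_⊎_; inj₁; inj₂)
open import Data.Empty using (⊥-elim)
open import Relation.Nullary using (¬_)
open import Function.Bundles using (_⇔_; mk⇔; Equivalence)
open import Relation.Binary.PropositionalEquality
  using (refl; sym; trans; cong; cong₂; subst; _≢_; module ≡-Reasoning)
open import Algebra.Properties.CommutativeSemigroup ℕₚ.+-commutativeSemigroup using (interchange)

open Equivalence using (to; from)

private
  variable
    m n k : ℕ
    S : Set
    c : ℤ
    s t : Step
    p q r p′ : Vec Step n

heightsFrom : (S → ℤ) → ℤ → Vec S n → Vec ℤ (suc n)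
heightsFrom h c []      = c ∷ []
heightsFrom h c (s ∷ v) = c ∷ heightsFrom h (c + h s) v

map-+-heightsFrom : (h : S → ℤ) (c a : ℤ) (v : Vec S n) →
                    map (λ x → c + x) (heightsFrom h a v) ≡ heightsFrom h (c + a) v
map-+-heightsFrom h c a []      = refl
map-+-heightsFrom h c a (s ∷ v) = cong (c + a ∷_) (trans
  (map-+-heightsFrom h c (a + h s) v)
  (cong (λ x → heightsFrom h x v) (sym (ℤₚ.+-assoc c a (h s)))))

heightsFrom-∷ : (h : S → ℤ) (s : S) (v : Vec S n) →
                + 0 ∷ map (λ x → h s + x) (heightsFrom h (+ 0) v) ≡ heightsFrom h (+ 0) (s ∷ v)
heightsFrom-∷ h s v = cong (+ 0 ∷_) (trans
  (map-+-heightsFrom h (h s) (+ 0) v)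
  (cong (λ x → heightsFrom h x v) (ℤₚ.+-comm (h s) (+ 0))))

heights≡heightsFrom : (p : Vec Step n) → heights p ≡ heightsFrom stepVal (+ 0) p
heights≡heightsFrom []      = refl
heights≡heightsFrom (s ∷ p) =
  trans (cong (λ hs → + 0 ∷ map (λ x → stepVal s + x) hs) (heights≡heightsFrom p)) (heightsFrom-∷ stepVal s p)

heights4≡heightsFrom : (r : Vec Step4 n) → heights4 r ≡ heightsFrom step4Val (+ 0) r
heights4≡heightsFrom []      = refl
heights4≡heightsFrom (s ∷ r) =
  trans (cong (λ hs → + 0 ∷ map (λ x → step4Val s + x) hs) (heights4≡heightsFrom r)) (heightsFrom-∷ step4Val s r)

Δ : Step → Step → ℤ
Δ s t = step4Val (A-step s t)

gaps : ℤ → Vec Step n → Vec Step n → Vec ℤ (suc n)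
gaps c p q = heightsFrom step4Val c (A p q)

δ : ℤ → Vec Step n → Vec Step n → ℕ
δ c p q = sumAbs (gaps c p q)

NonNeg : Vec ℤ m → Set
NonNeg = All (+ 0 ℤ.≤_)

_⊑_ : Vec Step n → Vec Step n → Set
p ⊑ q = NonNeg (gaps (+ 0) p q)

Δ-double : ∀ s t → Δ s t + Δ s t + stepVal s ≡ stepVal t
Δ-double U U = refl
Δ-double U D = refl
Δ-double D U = refl
Δ-double D D = refl

Δ-swap : ∀ s t → Δ t s ≡ - Δ s t
Δ-swap U U = refl
Δ-swap U D = refl
Δ-swap D U = refl
Δ-swap D D = refl

Δ-trans : ∀ s u t → Δ s u + Δ u t ≡ Δ s t
Δ-trans U U U = refl
Δ-trans U U D = refl
Δ-trans U D U = refl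
Δ-trans U D D = refl
Δ-trans D U U = refl
Δ-trans D U D = refl
Δ-trans D D U = refl
Δ-trans D D D = refl

Δ-D≡Δ-U+1 : ∀ t → Δ D t ≡ Δ U t + + 1
Δ-D≡Δ-U+1 U = refl
Δ-D≡Δ-U+1 D = refl

Δ≡0⇒≡ : ∀ s t → + 0 + Δ s t ≡ + 0 → s ≡ t
Δ≡0⇒≡ U U _ = refl
Δ≡0⇒≡ D D _ = refl

gaps-double+heights : ∀ c a (p q : Vec Step n) →
  zipWith (λ g x → g + g + x) (gaps c p q) (heightsFrom stepVal a p) ≡ heightsFrom stepVal (c + c + a) q
gaps-double+heights c a []      []      = refl
gaps-double+heights c a (s ∷ p) (t ∷ q) = cong (c + c + a ∷_) (begin
  zipWith (λ g x → g + g + x) (gaps (c + Δ s t) p q) (heightsFrom stepVal (a + stepVal s) p)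
    ≡⟨ gaps-double+heights (c + Δ s t) (a + stepVal s) p q ⟩
  heightsFrom stepVal ((c + Δ s t) + (c + Δ s t) + (a + stepVal s)) q
    ≡⟨ cong (λ x → heightsFrom stepVal x q) (trans (regroup c a (Δ s t) (stepVal s))
                                                    (cong (λ x → c + c + a + x) (Δ-double s t))) ⟩
  heightsFrom stepVal (c + c + a + stepVal t) q ∎)
  where
  open ≡-Reasoning
  regroup : ∀ c a d x → (c + d) + (c + d) + (a + x) ≡ (c + c + a) + (d + d + x)
  regroup = solve-∀

gap-double+height : (p q : Vec Step n) (i : Fin (suc n)) →
  lookup (gaps (+ 0) p q) i + lookup (gaps (+ 0) p q) i + lookup (heights p) i ≡ lookup (heights q) i
gap-double+height p q i = begin
  g + g + lookup (heights p) i                          ≡⟨ cong (λ hs → g + g + lookup hs i) (heights≡heightsFrom p) ⟩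
  g + g + lookup (heightsFrom stepVal (+ 0) p) i        ≡⟨ sym (lookup-zipWith _ i (gaps (+ 0) p q) _) ⟩
  lookup (zipWith (λ g x → g + g + x) (gaps (+ 0) p q) (heightsFrom stepVal (+ 0) p)) i
                                                        ≡⟨ cong (λ hs → lookup hs i) (gaps-double+heights (+ 0) (+ 0) p q) ⟩
  lookup (heightsFrom stepVal (+ 0) q) i                ≡⟨ cong (λ hs → lookup hs i) (sym (heights≡heightsFrom q)) ⟩
  lookup (heights q) i                                  ∎
  where
  open ≡-Reasoning
  g : ℤ
  g = lookup (gaps (+ 0) p q) i

gaps-swap : ∀ c (p q : Vec Step n) → gaps (- c) q p ≡ map -_ (gaps c p q)
gaps-swap c []      []      = refl
gaps-swap c (s ∷ p) (t ∷ q) = cong (- c ∷_) (trans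
  (cong (λ x → gaps x q p) (trans (cong (λ x → - c + x) (Δ-swap s t)) (sym (ℤₚ.neg-distrib-+ c (Δ s t)))))
  (gaps-swap (c + Δ s t) p q))

gaps-trans : ∀ a b (p r q : Vec Step n) → gaps (a + b) p q ≡ zipWith _+_ (gaps a p r) (gaps b r q)
gaps-trans a b []      []      []      = refl
gaps-trans a b (s ∷ p) (u ∷ r) (t ∷ q) = cong (a + b ∷_) (trans
  (cong (λ x → gaps x p q) (trans (cong (λ x → a + b + x) (sym (Δ-trans s u t))) (regroup a b (Δ s u) (Δ u t))))
  (gaps-trans (a + Δ s u) (b + Δ u t) p r q))
  where
  regroup : ∀ a b x y → (a + b) + (x + y) ≡ (a + x) + (b + y)
  regroup = solve-∀

sumAbs-map-neg : (xs : Vec ℤ m) → sumAbs (map -_ xs) ≡ sumAbs xs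
sumAbs-map-neg []       = refl
sumAbs-map-neg (x ∷ xs) = cong₂ ℕ._+_ (ℤₚ.∣-i∣≡∣i∣ x) (sumAbs-map-neg xs)

sumAbs-zipWith-+ : (xs ys : Vec ℤ m) → sumAbs (zipWith _+_ xs ys) ≤ sumAbs xs ℕ.+ sumAbs ys
sumAbs-zipWith-+ []       []       = z≤n
sumAbs-zipWith-+ (x ∷ xs) (y ∷ ys) = ℕₚ.≤-trans
  (ℕₚ.+-mono-≤ (ℤₚ.∣i+j∣≤∣i∣+∣j∣ x y) (sumAbs-zipWith-+ xs ys))
  (ℕₚ.≤-reflexive (interchange ∣ x ∣ ∣ y ∣ (sumAbs xs) (sumAbs ys)))

sumAbs-zipWith-+-nonneg : {xs ys : Vec ℤ m} → NonNeg xs → NonNeg ys →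
                          sumAbs (zipWith _+_ xs ys) ≡ sumAbs xs ℕ.+ sumAbs ys
sumAbs-zipWith-+-nonneg []                        []                        = refl
sumAbs-zipWith-+-nonneg {xs = + a ∷ xs} {+ b ∷ ys} (+≤+ _ ∷ xs≥0) (+≤+ _ ∷ ys≥0) =
  trans (cong (a ℕ.+ b ℕ.+_) (sumAbs-zipWith-+-nonneg xs≥0 ys≥0)) (interchange a b (sumAbs xs) (sumAbs ys))

δ-sym : ∀ c (p q : Vec Step n) → δ c p q ≡ δ (- c) q p
δ-sym c p q = sym (trans (cong sumAbs (gaps-swap c p q)) (sumAbs-map-neg (gaps c p q)))

δ-triangle : ∀ a b (p r q : Vec Step n) → δ (a + b) p q ≤ δ a p r ℕ.+ δ b r q
δ-triangle a b p r q =
  subst (_≤ δ a p r ℕ.+ δ b r q) (cong sumAbs (sym (gaps-trans a b p r q))) (sumAbs-zipWith-+ (gaps a p r) (gaps b r q))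

δ-additive : ∀ a b (p r q : Vec Step n) → NonNeg (gaps a p r) → NonNeg (gaps b r q) →
             δ (a + b) p q ≡ δ a p r ℕ.+ δ b r q
δ-additive a b p r q p⊑r r⊑q =
  trans (cong sumAbs (gaps-trans a b p r q)) (sumAbs-zipWith-+-nonneg p⊑r r⊑q)

δ-refl : (p : Vec Step n) → δ (+ 0) p p ≡ 0
δ-refl []      = refl
δ-refl (U ∷ p) = δ-refl p
δ-refl (D ∷ p) = δ-refl p

⊑-refl : (p : Vec Step n) → p ⊑ p
⊑-refl []      = +≤+ z≤n ∷ []
⊑-refl (U ∷ p) = +≤+ z≤n ∷ ⊑-refl p
⊑-refl (D ∷ p) = +≤+ z≤n ∷ ⊑-refl p

δ≡0⇒≡ : ∀ c (p q : Vec Step n) → δ c p q ≡ 0 → c ≡ + 0 × p ≡ q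
δ≡0⇒≡ c []      []      δ≡0 = ℤₚ.∣i∣≡0⇒i≡0 (ℕₚ.m+n≡0⇒m≡0 ∣ c ∣ δ≡0) , refl
δ≡0⇒≡ c (s ∷ p) (t ∷ q) δ≡0
  with refl ← ℤₚ.∣i∣≡0⇒i≡0 {c} (ℕₚ.m+n≡0⇒m≡0 ∣ c ∣ δ≡0)
  with head≡0 , p≡q ← δ≡0⇒≡ (c + Δ s t) p q (ℕₚ.m+n≡0⇒n≡0 ∣ c ∣ δ≡0)
  = refl , cong₂ _∷_ (Δ≡0⇒≡ s t head≡0) p≡q

double+≡⇒≤⇔0≤ : ∀ g x y → g + g + x ≡ y → (x ℤ.≤ y ⇔ + 0 ℤ.≤ g)
double+≡⇒≤⇔0≤ g x y e = mk⇔ ≤⇒0≤ 0≤⇒≤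
  where
  cancel : ∀ g x → (g + g + x) - x ≡ g + g
  cancel = solve-∀
  0≤double⇒0≤ : ∀ g → + 0 ℤ.≤ g + g → + 0 ℤ.≤ g
  0≤double⇒0≤ (+ _)    _  = +≤+ z≤n
  0≤double⇒0≤ -[1+ _ ] ()
  ≤⇒0≤ : x ℤ.≤ y → + 0 ℤ.≤ g
  ≤⇒0≤ x≤y = 0≤double⇒0≤ g
    (subst (+ 0 ℤ.≤_) (trans (cong (_- x) (sym e)) (cancel g x)) (ℤₚ.i≤j⇒0≤j-i x≤y))
  0≤⇒≤ : + 0 ℤ.≤ g → x ℤ.≤ y
  0≤⇒≤ (+≤+ {n = a} _) = subst (x ℤ.≤_) e (ℤₚ.i≤j+i x (+ a + + a))

double+≡⇒≡0 : ∀ g x → g + g + x ≡ x → g ≡ + 0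
double+≡⇒≡0 g x e = double≡0⇒≡0 g (trans (sym (cancel g x)) (trans (cong (_- x) e) (ℤₚ.+-inverseʳ x)))
  where
  cancel : ∀ g x → (g + g + x) - x ≡ g + g
  cancel = solve-∀
  double≡0⇒≡0 : ∀ g → g + g ≡ + 0 → g ≡ + 0
  double≡0⇒≡0 (+ zero) _ = refl

≼⇔⊑ : p ≼ q ⇔ p ⊑ q
≼⇔⊑ {p = p} {q} = mk⇔
  (λ p≼q → lookup⁻ λ i → to (pointwise i) (p≼q i))
  (λ p⊑q i → from (pointwise i) (lookup⁺ p⊑q i))
  where
  pointwise : ∀ i → lookup (heights p) i ℤ.≤ lookup (heights q) i ⇔ + 0 ℤ.≤ lookup (gaps (+ 0) p q) i
  pointwise i = double+≡⇒≤⇔0≤ _ _ _ (gap-double+height p q i)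

gaps-end≡0 : InP n k p → InP n k q → lookup (gaps (+ 0) p q) (fromℕ n) ≡ + 0
gaps-end≡0 {p = p} {q = q} p∈P q∈P =
  double+≡⇒≡0 _ _ (trans (gap-double+height p q (fromℕ _)) (trans q∈P (sym p∈P)))

gaps-end≡0⇒InP : InP n k q → lookup (gaps (+ 0) p q) (fromℕ n) ≡ + 0 → InP n k p
gaps-end≡0⇒InP {q = q} {p = p} q∈P end≡0 = begin
  x                    ≡⟨ sym (ℤₚ.+-identityˡ x) ⟩
  + 0 + x              ≡⟨ cong (λ g → g + g + x) (sym end≡0) ⟩
  g + g + x            ≡⟨ gap-double+height p q (fromℕ _) ⟩
  lookup (heights q) (fromℕ _) ≡⟨ q∈P ⟩
  _ ∎
  where
  open ≡-Reasoning
  x g : ℤ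
  x = lookup (heights p) (fromℕ _)
  g = lookup (gaps (+ 0) p q) (fromℕ _)

up : Step → ℕ
up U = 1
up D = 0

stepVal+1≡up+up : ∀ t → stepVal t + + 1 ≡ + up t + + up t
stepVal+1≡up+up U = refl
stepVal+1≡up+up D = refl

countUO₁-A-step-∷ : ∀ s t (r : Vec Step4 n) → countUO₁ (A-step s t ∷ r) ≡ up t ℕ.+ countUO₁ r
countUO₁-A-step-∷ U U r = refl
countUO₁-A-step-∷ U D r = refl
countUO₁-A-step-∷ D U r = refl
countUO₁-A-step-∷ D D r = refl

end+length≡offset+2count : ∀ c (p q : Vec Step n) →
  lookup (heightsFrom stepVal c q) (fromℕ n) + + n ≡ c + (+ countUO₁ (A p q) + + countUO₁ (A p q))
end+length≡offset+2count c []      []      = refl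
end+length≡offset+2count {suc n} c (s ∷ p) (t ∷ q) = begin
  x + (+ 1 + + n)                        ≡⟨ shift x (+ n) ⟩
  x + + n + + 1                          ≡⟨ cong (_+ + 1) (end+length≡offset+2count (c + stepVal t) p q) ⟩
  c + stepVal t + (+ j + + j) + + 1      ≡⟨ regroup c (stepVal t) (+ j) ⟩
  c + (stepVal t + + 1 + (+ j + + j))    ≡⟨ cong (λ y → c + (y + (+ j + + j))) (stepVal+1≡up+up t) ⟩
  c + (+ up t + + up t + (+ j + + j))    ≡⟨ cong (λ y → c + y) (interchange-ℤ (+ up t) (+ j)) ⟩
  c + (+ (up t ℕ.+ j) + + (up t ℕ.+ j))  ≡⟨ cong (λ i → c + (+ i + + i)) (sym (countUO₁-A-step-∷ s t (A p q))) ⟩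
  c + (+ countUO₁ (A (s ∷ p) (t ∷ q)) + + countUO₁ (A (s ∷ p) (t ∷ q))) ∎
  where
  open ≡-Reasoning
  x : ℤ
  x = lookup (heightsFrom stepVal (c + stepVal t) q) (fromℕ n)
  j : ℕ
  j = countUO₁ (A p q)
  shift : ∀ x n → x + (+ 1 + n) ≡ x + n + + 1
  shift = solve-∀
  regroup : ∀ c s b → c + s + (b + b) + + 1 ≡ c + (s + + 1 + (b + b))
  regroup = solve-∀
  interchange-ℤ : ∀ a b → a + a + (b + b) ≡ (a + b) + (a + b)
  interchange-ℤ = solve-∀

InP⇔countUO₁≡ : (p q : Vec Step n) → InP n k q ⇔ countUO₁ (A p q) ≡ k
InP⇔countUO₁≡ {n} {k} p q = mk⇔ InP⇒ups≡k ups≡k⇒InP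
  where
  open ≡-Reasoning
  ups : ℕ
  ups = countUO₁ (A p q)
  end : ℤ
  end = lookup (heights q) (fromℕ n)
  +2*≡++ : ∀ j → + (2 ℕ.* j) ≡ + j + + j
  +2*≡++ j = cong (λ x → + (j ℕ.+ x)) (ℕₚ.+-identityʳ j)
  end+n≡ups+ups : end + + n ≡ + ups + + ups
  end+n≡ups+ups = trans (cong (λ hs → lookup hs (fromℕ n) + + n) (heights≡heightsFrom q))
                        (trans (end+length≡offset+2count (+ 0) p q) (ℤₚ.+-identityˡ _))
  sub-add : ∀ a b → a - b + b ≡ a
  sub-add = solve-∀
  add-sub : ∀ a b → a + b - b ≡ a
  add-sub = solve-∀
  InP⇒ups≡k : InP n k q → ups ≡ k
  InP⇒ups≡k q∈P = ℕₚ.*-cancelˡ-≡ ups k 2 (ℤₚ.+-injective (begin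
    + (2 ℕ.* ups)           ≡⟨ +2*≡++ ups ⟩
    + ups + + ups           ≡⟨ sym end+n≡ups+ups ⟩
    end + + n               ≡⟨ cong (_+ + n) q∈P ⟩
    + (2 ℕ.* k) - + n + + n ≡⟨ sub-add (+ (2 ℕ.* k)) (+ n) ⟩
    + (2 ℕ.* k)             ∎))
  ups≡k⇒InP : ups ≡ k → InP n k q
  ups≡k⇒InP refl = begin
    end                     ≡⟨ sym (add-sub end (+ n)) ⟩
    end + + n - + n         ≡⟨ cong (_- + n) (trans end+n≡ups+ups (sym (+2*≡++ ups))) ⟩
    + (2 ℕ.* ups) - + n     ∎

leftStep rightStep : Step4 → Step
leftStep U′ = D
leftStep D′ = U
leftStep O₁ = U
leftStep O₂ = D
rightStep U′ = U
rightStep D′ = D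
rightStep O₁ = U
rightStep O₂ = D

leftStep-A-step : ∀ s t → leftStep (A-step s t) ≡ s
leftStep-A-step U U = refl
leftStep-A-step U D = refl
leftStep-A-step D U = refl
leftStep-A-step D D = refl

rightStep-A-step : ∀ s t → rightStep (A-step s t) ≡ t
rightStep-A-step U U = refl
rightStep-A-step U D = refl
rightStep-A-step D U = refl
rightStep-A-step D D = refl

map-leftStep-A : (p q : Vec Step n) → map leftStep (A p q) ≡ p
map-leftStep-A []      []      = refl
map-leftStep-A (s ∷ p) (t ∷ q) = cong₂ _∷_ (leftStep-A-step s t) (map-leftStep-A p q)

map-rightStep-A : (p q : Vec Step n) → map rightStep (A p q) ≡ q
map-rightStep-A []      []      = refl
map-rightStep-A (s ∷ p) (t ∷ q) = cong₂ _∷_ (rightStep-A-step s t) (map-rightStep-A p q)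

A-map-leftStep-rightStep : (r : Vec Step4 n) → A (map leftStep r) (map rightStep r) ≡ r
A-map-leftStep-rightStep []        = refl
A-map-leftStep-rightStep (U′ ∷ r) = cong (U′ ∷_) (A-map-leftStep-rightStep r)
A-map-leftStep-rightStep (D′ ∷ r) = cong (D′ ∷_) (A-map-leftStep-rightStep r)
A-map-leftStep-rightStep (O₁ ∷ r) = cong (O₁ ∷_) (A-map-leftStep-rightStep r)
A-map-leftStep-rightStep (O₂ ∷ r) = cong (O₂ ∷_) (A-map-leftStep-rightStep r)

A-injective : (p q p′ q′ : Vec Step n) → A p q ≡ A p′ q′ → p ≡ p′ × q ≡ q′
A-injective p q p′ q′ e =
    trans (sym (map-leftStep-A p q)) (trans (cong (map leftStep) e) (map-leftStep-A p′ q′))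
  , trans (sym (map-rightStep-A p q)) (trans (cong (map rightStep) e) (map-rightStep-A p′ q′))

A∈W : (p q : Vec Step n) → InP n k p → InP n k q → InW n k (A p q)
A∈W {n} {k} p q p∈P q∈P =
    trans (cong (λ hs → lookup hs (fromℕ n)) (heights4≡heightsFrom (A p q)))
          (gaps-end≡0 {k = k} {p = p} {q = q} p∈P q∈P)
  , to (InP⇔countUO₁≡ p q) q∈P

A-surjective : (r : Vec Step4 n) → InW n k r →
               Σ[ p ∈ Vec Step n ] Σ[ q ∈ Vec Step n ] (InP n k p × InP n k q × A p q ≡ r)
A-surjective {n} {k} r (end≡0 , count≡k) = p₀ , q₀ , p₀∈P , q₀∈P , A-map-leftStep-rightStep r
  where
  p₀ q₀ : Vec Step n
  p₀ = map leftStep r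
  q₀ = map rightStep r
  q₀∈P : InP n k q₀
  q₀∈P = from (InP⇔countUO₁≡ p₀ q₀) (trans (cong countUO₁ (A-map-leftStep-rightStep r)) count≡k)
  p₀∈P : InP n k p₀
  p₀∈P = gaps-end≡0⇒InP {k = k} {p = p₀} q₀∈P (trans
    (cong (λ r′ → lookup r′ (fromℕ n)) (trans (sym (heights4≡heightsFrom (A p₀ q₀)))
                                               (cong heights4 (A-map-leftStep-rightStep r))))
    end≡0)

data Flip : Vec Step n → Vec Step n → Set where
  here  : {w : Vec Step n} → Flip (D ∷ U ∷ w) (U ∷ D ∷ w)
  there : {w w′ : Vec Step n} → Flip w w′ → Flip (s ∷ w) (s ∷ w′)

Flip-end : Flip p p′ → ∀ c →
           lookup (heightsFrom stepVal c p) (fromℕ n) ≡ lookup (heightsFrom stepVal c p′) (fromℕ n)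
Flip-end (here {w = w}) c = cong (λ x → lookup (heightsFrom stepVal x w) (fromℕ _)) (swap c)
  where
  swap : ∀ c → c + - (+ 1) + + 1 ≡ c + + 1 + - (+ 1)
  swap = solve-∀
Flip-end (there {s = s} f) c = Flip-end f (c + stepVal s)

Flip-InP : InP n k p → Flip p p′ → InP n k p′
Flip-InP {p = p} {p′ = p′} p∈P f = begin
  lookup (heights p′) (fromℕ _)                  ≡⟨ cong (λ hs → lookup hs (fromℕ _)) (heights≡heightsFrom p′) ⟩
  lookup (heightsFrom stepVal (+ 0) p′) (fromℕ _) ≡⟨ sym (Flip-end f (+ 0)) ⟩
  lookup (heightsFrom stepVal (+ 0) p) (fromℕ _)  ≡⟨ cong (λ hs → lookup hs (fromℕ _)) (sym (heights≡heightsFrom p)) ⟩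
  lookup (heights p) (fromℕ _)                   ≡⟨ p∈P ⟩
  _ ∎
  where open ≡-Reasoning

Flip-irrefl : Flip p p′ → p ≢ p′
Flip-irrefl here      ()
Flip-irrefl (there f) e = Flip-irrefl f (∷-injectiveʳ e)

δ-Flip : Flip p p′ → δ (+ 0) p p′ ≡ 1
δ-Flip (here {w = w})    = cong suc (δ-refl w)
δ-Flip (there {s = U} f) = δ-Flip f
δ-Flip (there {s = D} f) = δ-Flip f

Flip-⊑ : Flip p p′ → p ⊑ p′
Flip-⊑ (here {w = w})    = +≤+ z≤n ∷ +≤+ z≤n ∷ ⊑-refl w
Flip-⊑ (there {s = U} f) = +≤+ z≤n ∷ Flip-⊑ f
Flip-⊑ (there {s = D} f) = +≤+ z≤n ∷ Flip-⊑ f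

Flip⇒Covers : InP n k p → Flip p p′ → Covers n k p p′
Flip⇒Covers {n} {k} {p} {p′} p∈P f =
  p∈P , Flip-InP {k = k} p∈P f , from ≼⇔⊑ (Flip-⊑ f) , Flip-irrefl f , between
  where
  1≡+⇒ : ∀ a b → 1 ≡ a ℕ.+ b → a ≡ 0 ⊎ b ≡ 0
  1≡+⇒ zero    b _ = inj₁ refl
  1≡+⇒ (suc a) b e = inj₂ (ℕₚ.m+n≡0⇒n≡0 a (sym (ℕₚ.suc-injective e)))
  between : (r : Vec Step n) → InP n k r → p ≼ r → r ≼ p′ → r ≡ p ⊎ r ≡ p′
  between r _ p≼r r≼p′
    with 1≡+⇒ (δ (+ 0) p r) (δ (+ 0) r p′)
                (trans (sym (δ-Flip f)) (δ-additive (+ 0) (+ 0) p r p′ (to ≼⇔⊑ p≼r) (to ≼⇔⊑ r≼p′)))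
  ... | inj₁ δ≡0 = inj₁ (sym (proj₂ (δ≡0⇒≡ (+ 0) p r δ≡0)))
  ... | inj₂ δ≡0 = inj₂ (proj₂ (δ≡0⇒≡ (+ 0) r p′ δ≡0))

data Improvement (c : ℤ) (p q : Vec Step n) : Set where
  improve : Flip p p′ → suc (δ c p′ q) ≡ δ c p q →
            (NonNeg (gaps c p q) → NonNeg (gaps c p′ q)) → Improvement c p q

+1≤x+1⇒∣x+1∣≡suc∣x∣ : ∀ x → + 1 ℤ.≤ x + + 1 → ∣ x + + 1 ∣ ≡ suc ∣ x ∣ × + 0 ℤ.≤ x
+1≤x+1⇒∣x+1∣≡suc∣x∣ (+ a)        _          = ℕₚ.+-comm a 1 , +≤+ z≤n
+1≤x+1⇒∣x+1∣≡suc∣x∣ -[1+ zero ]  (+≤+ ())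
+1≤x+1⇒∣x+1∣≡suc∣x∣ -[1+ suc a ] ()

≤-+Δ-D : ∀ {x y} t → x ℤ.≤ y → x ℤ.≤ y + Δ D t
≤-+Δ-D {y = y} U x≤y = ℤₚ.≤-trans x≤y (ℤₚ.i≤i+j y (+ 1))
≤-+Δ-D {y = y} D x≤y = subst (_ ℤ.≤_) (sym (ℤₚ.+-identityʳ y)) x≤y

-- While p keeps stepping D, the gap of A(p,q) stays ≥ 1; at the next U of p, swapping that
-- DU lowers a single gap, which was ≥ 1, by one.
raise : ∀ c (p : Vec Step m) t q → + 1 ℤ.≤ c + Δ D t →
        lookup (gaps c (D ∷ p) (t ∷ q)) (fromℕ (suc m)) ≡ + 0 → Improvement c (D ∷ p) (t ∷ q)
raise c []      t []       gap≥1 end≡0 with +≤+ () ← subst (+ 1 ℤ.≤_) end≡0 gap≥1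
raise c (U ∷ p) t (t′ ∷ q) gap≥1 _     = improve here δ-lowered nonneg-kept
  where
  c₀ c₁ : ℤ
  c₀ = c + Δ U t
  c₁ = c + Δ D t
  c₁≡c₀+1 : c₁ ≡ c₀ + + 1
  c₁≡c₀+1 = trans (cong (λ x → c + x) (Δ-D≡Δ-U+1 t)) (sym (ℤₚ.+-assoc c (Δ U t) (+ 1)))
  shuffle : ∀ a b → a + + 1 + b ≡ a + (b + + 1)
  shuffle = solve-∀
  rejoin : c₁ + Δ U t′ ≡ c₀ + Δ D t′
  rejoin = trans (cong (_+ Δ U t′) c₁≡c₀+1)
                 (trans (shuffle c₀ (Δ U t′)) (cong (λ x → c₀ + x) (sym (Δ-D≡Δ-U+1 t′))))
  abs-c₁ : ∣ c₀ + + 1 ∣ ≡ suc ∣ c₀ ∣ × + 0 ℤ.≤ c₀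
  abs-c₁ = +1≤x+1⇒∣x+1∣≡suc∣x∣ c₀ (subst (+ 1 ℤ.≤_) c₁≡c₀+1 gap≥1)
  δ-lowered : suc (∣ c ∣ ℕ.+ (∣ c₀ ∣ ℕ.+ δ (c₀ + Δ D t′) p q))
            ≡ ∣ c ∣ ℕ.+ (∣ c₁ ∣ ℕ.+ δ (c₁ + Δ U t′) p q)
  δ-lowered = trans (sym (ℕₚ.+-suc ∣ c ∣ _)) (cong (∣ c ∣ ℕ.+_)
    (cong₂ ℕ._+_ (sym (trans (cong ∣_∣ c₁≡c₀+1) (proj₁ abs-c₁))) (cong (λ x → δ x p q) (sym rejoin))))
  nonneg-kept : NonNeg (gaps c (D ∷ U ∷ p) (t ∷ t′ ∷ q)) → NonNeg (gaps c (U ∷ D ∷ p) (t ∷ t′ ∷ q))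
  nonneg-kept (c≥0 ∷ _ ∷ rest) = c≥0 ∷ proj₂ abs-c₁ ∷ subst (λ x → NonNeg (gaps x p q)) rejoin rest
raise c (D ∷ p) t (t′ ∷ q) gap≥1 end≡0
  with improve f dec nonneg-kept ← raise (c + Δ D t) p t′ q (≤-+Δ-D t′ gap≥1) end≡0
  = improve (there f) (trans (sym (ℕₚ.+-suc ∣ c ∣ _)) (cong (∣ c ∣ ℕ.+_) dec))
            λ { (c≥0 ∷ rest) → c≥0 ∷ nonneg-kept rest }

data Descent (p q : Vec Step n) : Set where
  equal       : p ≡ q → Descent p q
  raise-left  : Improvement (+ 0) p q → Descent p q
  raise-right : Improvement (+ 0) q p → ¬ p ⊑ q → Descent p q

Improvement-∷ : Improvement (+ 0) p q → Improvement (+ 0) (s ∷ p) (s ∷ q)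
Improvement-∷ {s = U} (improve f dec nonneg-kept) = improve (there f) dec λ { (z ∷ rest) → z ∷ nonneg-kept rest }
Improvement-∷ {s = D} (improve f dec nonneg-kept) = improve (there f) dec λ { (z ∷ rest) → z ∷ nonneg-kept rest }

Descent-∷ : Descent p q → Descent (s ∷ p) (s ∷ q)
Descent-∷         (equal refl)        = equal refl
Descent-∷         (raise-left i)      = raise-left (Improvement-∷ i)
Descent-∷ {s = U} (raise-right i p⋢q) = raise-right (Improvement-∷ i) λ { (_ ∷ rest) → p⋢q rest }
Descent-∷ {s = D} (raise-right i p⋢q) = raise-right (Improvement-∷ i) λ { (_ ∷ rest) → p⋢q rest }

NonNeg-offset : (h : S → ℤ) (v : Vec S m) → NonNeg (heightsFrom h c v) → + 0 ℤ.≤ c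
NonNeg-offset h []      (c≥0 ∷ _) = c≥0
NonNeg-offset h (_ ∷ _) (c≥0 ∷ _) = c≥0

gaps-end-swap : (p q : Vec Step n) → lookup (gaps (+ 0) p q) (fromℕ n) ≡ + 0 →
                lookup (gaps (+ 0) q p) (fromℕ n) ≡ + 0
gaps-end-swap {n} p q end≡0 = trans (cong (λ hs → lookup hs (fromℕ n)) (gaps-swap (+ 0) p q))
                                     (trans (lookup-map (fromℕ n) -_ (gaps (+ 0) p q)) (cong -_ end≡0))

descent : (p q : Vec Step n) → lookup (gaps (+ 0) p q) (fromℕ n) ≡ + 0 → Descent p q
descent []      []      _     = equal refl
descent (U ∷ p) (U ∷ q) end≡0 = Descent-∷ (descent p q end≡0)
descent (D ∷ p) (D ∷ q) end≡0 = Descent-∷ (descent p q end≡0)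
descent (D ∷ p) (U ∷ q) end≡0 = raise-left (raise (+ 0) p U q (+≤+ (s≤s z≤n)) end≡0)
descent (U ∷ p) (D ∷ q) end≡0 =
  raise-right (raise (+ 0) q U p (+≤+ (s≤s z≤n)) (gaps-end-swap (U ∷ p) (D ∷ q) end≡0))
              λ { (_ ∷ rest) → 0≰-1 (NonNeg-offset step4Val (A p q) rest) }
  where
  0≰-1 : ¬ (+ 0 ℤ.≤ -[1+ 0 ])
  0≰-1 ()

Covers⇒δ≡1 : Covers n k p r → δ (+ 0) p r ≡ 1
Covers⇒δ≡1 {k = k} {p = p} {r = r} (p∈P , r∈P , p≼r , p≢r , between)
  with descent p r (gaps-end≡0 {k = k} {p = p} {q = r} p∈P r∈P)
... | equal p≡r         = ⊥-elim (p≢r p≡r)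
... | raise-right _ p⋢r = ⊥-elim (p⋢r (to ≼⇔⊑ p≼r))
... | raise-left (improve {p′ = p′} f _ nonneg-kept)
  with between p′ (Flip-InP {k = k} p∈P f) (from ≼⇔⊑ (Flip-⊑ f)) (from ≼⇔⊑ (nonneg-kept (to ≼⇔⊑ p≼r)))
...   | inj₁ p′≡p = ⊥-elim (Flip-irrefl f (sym p′≡p))
...   | inj₂ p′≡r = subst (λ x → δ (+ 0) p x ≡ 1) p′≡r (δ-Flip f)

Walk-snoc : Walk n k p r m → (Covers n k r q ⊎ Covers n k q r) → InP n k q → Walk n k p q (suc m)
Walk-snoc (here _)        cover q∈P = step cover (here q∈P)
Walk-snoc (step cover′ w) cover q∈P = step cover′ (Walk-snoc w cover q∈P)

walk-of-length-δ : ∀ m → InP n k p → InP n k q → δ (+ 0) p q ≡ m → Walk n k p q m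
walk-of-length-δ {p = p} {q = q} zero p∈P q∈P δ≡0
  with refl ← proj₂ (δ≡0⇒≡ (+ 0) p q δ≡0) = here p∈P
walk-of-length-δ {k = k} {p = p} {q = q} (suc m) p∈P q∈P δ≡1+m
  with descent p q (gaps-end≡0 {k = k} {p = p} {q = q} p∈P q∈P)
... | equal refl = ⊥-elim (ℕₚ.0≢1+n (trans (sym (δ-refl p)) δ≡1+m))
... | raise-left (improve f dec _) =
  step (inj₁ (Flip⇒Covers {k = k} p∈P f))
       (walk-of-length-δ m (Flip-InP {k = k} p∈P f) q∈P (ℕₚ.suc-injective (trans dec δ≡1+m)))
... | raise-right (improve {p′ = q′} f dec _) _ =
  Walk-snoc (walk-of-length-δ m p∈P (Flip-InP {k = k} q∈P f) (ℕₚ.suc-injective δ[p,q′]+1≡1+m))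
            (inj₂ (Flip⇒Covers {k = k} q∈P f)) q∈P
  where
  δ[p,q′]+1≡1+m : suc (δ (+ 0) p q′) ≡ suc m
  δ[p,q′]+1≡1+m = trans (cong suc (δ-sym (+ 0) p q′)) (trans dec (trans (sym (δ-sym (+ 0) p q)) δ≡1+m))

δ≤length : Walk n k p q m → δ (+ 0) p q ≤ m
δ≤length {p = p} (here _) = ℕₚ.≤-reflexive (δ-refl p)
δ≤length {n} {k} {p} {q} (step {r = r} cover w) =
  ℕₚ.≤-trans (δ-triangle (+ 0) (+ 0) p r q) (ℕₚ.+-mono-≤ (ℕₚ.≤-reflexive (δ-cover cover)) (δ≤length w))
  where
  δ-cover : Covers n k p r ⊎ Covers n k r p → δ (+ 0) p r ≡ 1
  δ-cover (inj₁ p⋖r) = Covers⇒δ≡1 {k = k} p⋖r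
  δ-cover (inj₂ r⋖p) = trans (δ-sym (+ 0) p r) (Covers⇒δ≡1 {k = k} r⋖p)

HasseDist-δ : InP n k p → InP n k q → HasseDist n k p q (δ (+ 0) p q)
HasseDist-δ p∈P q∈P = walk-of-length-δ _ p∈P q∈P refl , λ _ → δ≤length

dPath-A≡δ : (p q : Vec Step n) → dPath (A p q) ≡ δ (+ 0) p q
dPath-A≡δ p q = cong sumAbs (heights4≡heightsFrom (A p q))

above-axis⇔⊑ : (p q : Vec Step n) → (∀ i → + 0 ℤ.≤ lookup (heights4 (A p q)) i) ⇔ p ⊑ q
above-axis⇔⊑ p q = mk⇔
  (λ above → lookup⁻ λ i → subst (λ hs → + 0 ℤ.≤ lookup hs i) (heights4≡heightsFrom (A p q)) (above i))
  (λ p⊑q i → subst (λ hs → + 0 ℤ.≤ lookup hs i) (sym (heights4≡heightsFrom (A p q))) (lookup⁺ p⊑q i))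

proposition2p2 : (n k : ℕ) → k ≤ n →
    -- A maps P × P into 𝒲_{n,k}
    ((p q : Vec Step n) → InP n k p → InP n k q → InW n k (A p q))
    -- A is injective on P × P
    × ((p q p' q' : Vec Step n) → InP n k p → InP n k q → InP n k p' → InP n k q' →
         A p q ≡ A p' q' → (p ≡ p') × (q ≡ q'))
    -- A is surjective onto 𝒲_{n,k}
    × ((r : Vec Step4 n) → InW n k r →
         Σ[ p ∈ Vec Step n ] Σ[ q ∈ Vec Step n ] (InP n k p × InP n k q × A p q ≡ r))
    -- Hasse distance d(p,q) = d(A(p,q))
    × ((p q : Vec Step n) → InP n k p → InP n k q → HasseDist n k p q (dPath (A p q)))
    -- restriction: p ≤ q iff A(p,q) ∈ ℳ_{n,k}
    × ((p q : Vec Step n) → InP n k p → InP n k q →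
         (p ≼ q → InM n k (A p q)) × (InM n k (A p q) → p ≼ q))
proposition2p2 n k _ =
    A∈W
  , (λ p q p' q' _ _ _ _ → A-injective p q p' q')
  , A-surjective
  , (λ p q p∈P q∈P → subst (HasseDist n k p q) (sym (dPath-A≡δ p q)) (HasseDist-δ p∈P q∈P))
  , (λ p q p∈P q∈P → (λ p≼q → A∈W p q p∈P q∈P , from (above-axis⇔⊑ p q) (to ≼⇔⊑ p≼q))
                   , (λ (_ , above) → from ≼⇔⊑ (to (above-axis⇔⊑ p q) above)))
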